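{- Let $(N_1,m_1)\vartriangleright_E(N_2,m_2)$ with both marked nets safe, let $G$ be a well-formed TFG for this equivalence, and let $\mathcal{C}$ be the concurrency relation of $G$; write $v\,\bar{\mathcal{C}}\,w$ for $\neg(v\,\mathcal{C}\,w)$. For every node $v$ of $G$, if $v\,\bar{\mathcal{C}}\,v$ then $v\,\bar{\mathcal{C}}\,w$ for all nodes $w$ of $G$.
   Context: A Petri net $N=(P,T,\mathrm{Pre},\mathrm{Post})$ has a finite set of places $P$, a finite set of transitions $T$, and flow functions $\mathrm{Pre},\mathrm{Post}:T\to(P\to\mathbb{N})$. A marking is $m:P\to\mathbb{N}$; $t$ is enabled at $m$ if $m\ge\mathrm{Pre}(t)$, and firing gives $m-\mathrm{Pre}(t)+\mathrm{Post}(t)$. $R(N,m_0)$ is the set of markings reachable from $m_0$ by finite (possibly empty) firing sequences. $(N,m_0)$ is safe if every reachable marking has at most one token in each place. Linear systems: $E$ is a finite collection of equations $x=y_1+\dots+y_l$, with variable set $\mathrm{fv}(E)$; solutions are non-negative integer; consistent means having a solution. For a partial map $c$ defined exactly on $v_1,\dots,v_k$, $[c]$ is the system $v_1=c(v_1),\dots,v_k=c(v_k)$; commas denote union. $E$-equivalence: $(N_1,m_1)\vartriangleright_E(N_2,m_2)$ (place sets $P_1,P_2$) iff (A1) $E,[m]$ consistent for every $m\in R(N_1,m_1)\cup R(N_2,m_2)$; (A2) $E,[m_1],[m_2]$ consistent; (A3) for all markings $m_1'$ of $N_1$, $m_2'$ of $N_2$ with $E,[m_1'],[m_2']$ consistent,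 $m_1'\in R(N_1,m_1)\iff m_2'\in R(N_2,m_2)$. TFGs: fix pairwise disjoint sets $K(n)$, $n\in\mathbb{N}$, of constant nodes of value $n$, disjoint from place/variable names; $K=\bigcup_nK(n)$. A TFG with places $P$ is $(V,R,A)$, $V=P\cup S$ with $S\subset K$ finite, $R,A\subseteq V\times V$ disjoint; $v\mathbin{\to\!\bullet} w$ iff $(v,w)\in R$, $v\mathbin{\circ\!\to} w$ iff $(v,w)\in A$, $v\to w$ for either. Roots have no incoming arc; $\circ$-leaves have no outgoing $A$-arc. $v\mathbin{\circ\!\to} X$: $X$ is the nonempty set of all $A$-successors of $v$; $X\mathbin{\to\!\bullet} v$: $X$ is the nonempty set of all $R$-predecessors of $v$. Well-formed TFG for $(N_1,m_1)\vartriangleright_E(N_2,m_2)$: (T1) $V\setminus K=P_1\cup P_2\cup\mathrm{fv}(E)$; (T2) nodes in $V\cap K$ are roots; (T3) not both $p\mathbin{\circ\!\to} q$ and $p'\to q$ with $p\ne p'$, and not both $p\mathbin{\to\!\bullet} q$ and $p\mathbin{\circ\!\to} q$; (T4) $v\mathbin{\circ\!\to} X$ or $X\mathbin{\to\!\bullet} v$ iff the equation $v=\sum_{x\in X}x$ is in $E$; (T5) acyclic; (T6) roots not in $K$ are exactly $P_2$, $\circ$-leaves not in $K$ exactly $P_1$. A configuration is a partial $c:V\to\mathbb{N}$ ($\bot$ where undefined) with $c(v)=n$ for $v\in V\cap K(n)$; total if defined everywhere; $c_{|N}$ is its restriction to the places of $N$. $c$ is well-defined if (CBot) whenever $v\to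 w$, $c(v)=\bot\iff c(w)=\bot$; (CEq) whenever $c(v)\ne\bot$ and ($v\mathbin{\circ\!\to} X$ or $X\mathbin{\to\!\bullet} v$), $c(v)=\sum_{x\in X}c(x)$. The concurrency relation $\mathcal{C}$ of $G$: $v\,\mathcal{C}\,w$ iff there is a total, well-defined configuration $c$ with $c_{|N_2}\in R(N_2,m_2)$, $c(v)>0$ and $c(w)>0$. -}

module Defs where

open import Data.Nat using (ℕ; _≤_; _<_; _+_; _∸_; suc)
open import Data.List using (List; []; _∷_; map)
open import Data.Nat.ListAction using (sum)
open import Data.List.Membership.Propositional using (_∈_)
open import Data.List.Relation.Unary.Unique.Propositional using (Unique)
open import Data.Maybe using (Maybe; just; nothing; fromMaybe)
open import Data.Product using (Σ; ∃; ∃-syntax; _×_; _,_)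
open import Data.Sum using (_⊎_; inj₁; inj₂)
open import Data.Empty using (⊥)
open import Relation.Nullary using (¬_)
open import Relation.Binary.PropositionalEquality using (_≡_; _≢_)
open import Relation.Binary.Construct.Closure.Transitive using (TransClosure)
open import Function.Bundles using (_⇔_)

-- Places and variables are drawn from an arbitrary type `Name`.
-- Constant nodes: `inj₂ (n , i)` is the i-th constant node of K(n)
-- (value n); the K(n) are pairwise disjoint, infinite, and disjoint
-- from names.

Node : Set → Set
Node Name = Name ⊎ (ℕ × ℕ)

IsConst : {Name : Set} → Node Name → Set
IsConst v = ∃[ n ] ∃[ i ] v ≡ inj₂ (n , i)

-- Petri nets.  A marking is a function Name → ℕ; only its values on the
-- places of the net matter (markings are compared on the places only).

Marking : Set → Set
Marking Name = Name → ℕ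

record Transition (Name : Set) : Set where
  field
    pre  : Name → ℕ
    post : Name → ℕ
open Transition public

record Net (Name : Set) : Set where
  field
    places      : List Name
    transitions : List (Transition Name)
open Net public

module _ {Name : Set} where

  Enabled : Net Name → Transition Name → Marking Name → Set
  Enabled N t m = ∀ p → p ∈ places N → pre t p ≤ m p

  fire : Transition Name → Marking Name → Marking Name
  fire t m p = m p ∸ pre t p + post t p

  data Steps (N : Net Name) (m₀ : Marking Name) : Marking Name → Set where
    done : Steps N m₀ m₀
    step : ∀ {m} (t : Transition Name) → t ∈ transitions N →
           Steps N m₀ m → Enabled N t m → Steps N m₀ (fire t m)

  _≈[_]_ : Marking Name → Net Name → Marking Name → Set
  m ≈[ N ] m' = ∀ p → p ∈ places N → m p ≡ m' p

  Reachable : Net Name → Marking Name → Marking Name → Set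
  Reachable N m₀ m = ∃[ m' ] (Steps N m₀ m' × m' ≈[ N ] m)

  Safe : Net Name → Marking Name → Set
  Safe N m₀ = ∀ m → Reachable N m₀ m → ∀ p → p ∈ places N → m p ≤ 1

-- Linear systems.  An equation is  lhs = rhs₁ + ... + rhsₗ , whose terms
-- are variables (inj₁ x) or constant nodes (value n).

  record Equation : Set where
    field
      lhs : Node Name
      rhs : List (Node Name)
  open Equation public

  System : Set
  System = List Equation

  eval : (Name → ℕ) → Node Name → ℕ
  eval σ (inj₁ x)       = σ x
  eval σ (inj₂ (n , _)) = n

  Solves : (Name → ℕ) → System → Set
  Solves σ E = ∀ e → e ∈ E → eval σ (lhs e) ≡ sum (map (eval σ) (rhs e))

  InFv : Name → System → Set
  InFv x E = ∃[ e ] (e ∈ E × (lhs e ≡ inj₁ x ⊎ inj₁ x ∈ rhs e))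

  Agrees : (Name → ℕ) → Net Name → Marking Name → Set
  Agrees σ N m = ∀ p → p ∈ places N → σ p ≡ m p

  Consistent₁ : System → Net Name → Marking Name → Set
  Consistent₁ E N m = ∃[ σ ] (Solves σ E × Agrees σ N m)

  Consistent₂ : System → Net Name → Marking Name → Net Name → Marking Name → Set
  Consistent₂ E N₁ m₁ N₂ m₂ =
    ∃[ σ ] (Solves σ E × Agrees σ N₁ m₁ × Agrees σ N₂ m₂)

  record EEquiv (E : System) (N₁ : Net Name) (m₁ : Marking Name)
                (N₂ : Net Name) (m₂ : Marking Name) : Set where
    field
      A1₁ : ∀ m → Reachable N₁ m₁ m → Consistent₁ E N₁ m
      A1₂ : ∀ m → Reachable N₂ m₂ m → Consistent₁ E N₂ m
      A2  : Consistent₂ E N₁ m₁ N₂ m₂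
      A3  : ∀ m₁' m₂' → Consistent₂ E N₁ m₁' N₂ m₂' →
            (Reachable N₁ m₁ m₁' ⇔ Reachable N₂ m₂ m₂')

  record TFG : Set where
    field
      V : List (Node Name)
      R : List (Node Name × Node Name)
      A : List (Node Name × Node Name)
      R⊆V×V : ∀ v w → (v , w) ∈ R → v ∈ V × w ∈ V
      A⊆V×V : ∀ v w → (v , w) ∈ A → v ∈ V × w ∈ V
      R∩A≡∅ : ∀ v w → (v , w) ∈ R → (v , w) ∈ A → ⊥
  open TFG public

  module _ (G : TFG) where
    _→•_ : Node Name → Node Name → Set
    v →• w = (v , w) ∈ R G

    _∘→_ : Node Name → Node Name → Set
    v ∘→ w = (v , w) ∈ A G

    Arc : Node Name → Node Name → Set
    Arc v w = v →• w ⊎ v ∘→ w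

    IsRoot : Node Name → Set
    IsRoot v = ∀ u → ¬ Arc u v

    IsLeaf∘ : Node Name → Set
    IsLeaf∘ v = ∀ u → ¬ (v ∘→ u)

  -- "the equation v = Σ_{x∈X} x is in E", X given as a predicate
  EqIn : System → Node Name → (Node Name → Set) → Set
  EqIn E v X = ∃[ e ] (e ∈ E × lhs e ≡ v × Unique (rhs e) ×
                       (∀ x → x ∈ rhs e ⇔ X x))

  record WellFormed (E : System) (N₁ : Net Name) (N₂ : Net Name)
                    (G : TFG) : Set where
    field
      T1  : ∀ x → inj₁ x ∈ V G ⇔ (x ∈ places N₁ ⊎ x ∈ places N₂ ⊎ InFv x E)
      T2  : ∀ v → v ∈ V G → IsConst v → IsRoot G v
      T3a : ∀ p p' q → _∘→_ G p q → Arc G p' q → p ≡ p'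
      T3b : ∀ p q → _→•_ G p q → _∘→_ G p q → ⊥
      T4∘ : ∀ v → (∃[ x ] _∘→_ G v x) → EqIn E v (λ x → _∘→_ G v x)
      T4• : ∀ v → (∃[ x ] _→•_ G x v) → EqIn E v (λ x → _→•_ G x v)
      T4E : ∀ e → e ∈ E → Unique (rhs e) →
            (rhs e ≢ []) ×
            ((∀ x → x ∈ rhs e ⇔ _∘→_ G (lhs e) x) ⊎
             (∀ x → x ∈ rhs e ⇔ _→•_ G x (lhs e)))
      T5  : ∀ v → ¬ TransClosure (Arc G) v v
      T6r : ∀ v → (v ∈ V G × ¬ IsConst v × IsRoot G v) ⇔
                  (∃[ p ] (v ≡ inj₁ p × p ∈ places N₂))
      T6l : ∀ v → (v ∈ V G × ¬ IsConst v × IsLeaf∘ G v) ⇔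
                  (∃[ p ] (v ≡ inj₁ p × p ∈ places N₁))

-- Configurations: partial maps V ⇀ ℕ (nothing = ⊥).

  Config : Set
  Config = Node Name → Maybe ℕ

  module _ (G : TFG) (c : Config) where
    ConstOK : Set
    ConstOK = ∀ n i → inj₂ (n , i) ∈ V G → c (inj₂ (n , i)) ≡ just n

    Total : Set
    Total = ∀ v → v ∈ V G → ∃[ n ] c v ≡ just n

    val : Node Name → ℕ
    val v = fromMaybe 0 (c v)

    CBot : Set
    CBot = ∀ v w → Arc G v w → (c v ≡ nothing ⇔ c w ≡ nothing)

    -- (CEq): xs ranges over duplicate-free enumerations of the set X
    CEq : Set
    CEq = ∀ v n → c v ≡ just n → ∀ (xs : List (Node Name)) → Unique xs → xs ≢ [] →
          ((∀ x → x ∈ xs ⇔ _∘→_ G v x) ⊎ (∀ x → x ∈ xs ⇔ _→•_ G x v)) →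
          n ≡ sum (map val xs)

    WellDefined : Set
    WellDefined = CBot × CEq

    -- c|N as a marking (only its values on the places of N matter)
    restrict : Marking Name
    restrict p = val (inj₁ p)

  Conc : TFG → Net Name → Marking Name → Node Name → Node Name → Set
  Conc G N₂ m₂ v w =
    ∃[ c ] (ConstOK G c × Total G c × WellDefined G c ×
            Reachable N₂ m₂ (restrict G c) ×
            ∃[ a ] (c v ≡ just a × 0 < a) ×
            ∃[ b ] (c w ≡ just b × 0 < b))

module Submission where

open import Defs
open import Data.List.Membership.Propositional using (_∈_)
open import Relation.Nullary using (¬_)
open import Data.Product using (_,_)

Conc⇒Conc-refl : {Name : Set} (G : TFG) (N₂ : Net Name) (m₂ : Marking Name) →
                 ∀ {v w} → Conc G N₂ m₂ v w → Conc G N₂ m₂ v v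
Conc⇒Conc-refl G N₂ m₂ (c , const , total , wd , reach , a , v>0 , _) =
  c , const , total , wd , reach , a , v>0 , a , v>0

lemma10 : {Name : Set} (E : System) (N₁ N₂ : Net Name) (m₁ m₂ : Marking Name) (G : TFG) →
          EEquiv E N₁ m₁ N₂ m₂ → Safe N₁ m₁ → Safe N₂ m₂ → WellFormed E N₁ N₂ G →
          ∀ v → v ∈ V G → ¬ Conc G N₂ m₂ v v →
          ∀ w → w ∈ V G → ¬ Conc G N₂ m₂ v w
lemma10 E N₁ N₂ m₁ m₂ G _ _ _ _ v _ ¬v𝒞v w _ v𝒞w = ¬v𝒞v (Conc⇒Conc-refl G N₂ m₂ v𝒞w)
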